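{- For every integer $n\geq 1$, $\gamma_2(G_{3,n})=\lceil 4n/3\rceil$.
   Context: For a graph $G$, a set $D\subseteq V(G)$ is a $2$-dominating set if every vertex not in $D$ has at least $2$ neighbours in $D$. The $2$-domination number $\gamma_2(G)$ is the minimum cardinality of a $2$-dominating set of $G$. The grid graph $G_{m,n}=P_m\times P_n$ has vertex set $[m]\times[n]$ (where $[k]=\{1,\dots,k\}$), with $(i,j)$ and $(i',j')$ adjacent iff $|i-i'|+|j-j'|=1$. -}

module Defs where

open import Data.Nat using (ℕ; zero; suc; _+_; _*_; _≤_; _/_; _≡ᵇ_)
open import Data.Bool using (Bool; true; false; _∧_; _∨_; if_then_else_)
open import Data.Fin using (Fin; toℕ)
open import Data.Fin.Properties using (_≟_)
open import Data.List using (List; map; allFin; concatMap)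
open import Data.Nat.ListAction using (sum)
open import Relation.Binary.PropositionalEquality using (_≡_)
open import Data.Product using (_×_; _,_; Σ)
open import Relation.Nullary using (¬_)
open import Relation.Nullary.Decidable using (⌊_⌋)

Vertex : ℕ → ℕ → Set
Vertex m n = Fin m × Fin n

diff1 : ℕ → ℕ → Bool
diff1 a b = ((suc a) ≡ᵇ b) ∨ ((suc b) ≡ᵇ a)

adj : ∀ {m n} → Vertex m n → Vertex m n → Bool
adj (i , j) (i' , j') =
  (⌊ i ≟ i' ⌋ ∧ diff1 (toℕ j) (toℕ j')) ∨ (⌊ j ≟ j' ⌋ ∧ diff1 (toℕ i) (toℕ i'))

VSet : ℕ → ℕ → Set
VSet m n = Vertex m n → Bool

vertices : ∀ m n → List (Vertex m n)
vertices m n = concatMap (λ i → map (λ j → (i , j)) (allFin n)) (allFin m)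

count : ∀ {m n} → (Vertex m n → Bool) → ℕ
count {m} {n} P = sum (map (λ v → if P v then 1 else 0) (vertices m n))

card : ∀ {m n} → VSet m n → ℕ
card D = count D

nbrsIn : ∀ {m n} → VSet m n → Vertex m n → ℕ
nbrsIn D v = count (λ u → adj v u ∧ D u)

Is2Dominating : ∀ {m n} → VSet m n → Set
Is2Dominating {m} {n} D = (v : Vertex m n) → D v ≡ false → 2 ≤ nbrsIn D v

Gamma2Is : ℕ → ℕ → ℕ → Set
Gamma2Is m n k =
  Σ (VSet m n) (λ D → Is2Dominating D × card D ≡ k)
  × ((D : VSet m n) → Is2Dominating D → k ≤ card D)

module Submission where

-- Read a set D ⊆ V(G_{3,n}) column by column. Being 2-dominating is a condition on every window of three
-- consecutive columns (the grid padded by an empty column at each end). A potential Φ on pairs of consecutive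
-- columns satisfies Φ(p, q) + 4 ≤ 3|q| + Φ(q, r) on every admissible window (p, q, r), Φ(∅, q) ≥ 1 and
-- Φ(p, ∅) ≤ 1; summing over the n windows gives 4n ≤ 3|D|, i.e. |D| ≥ ⌈4n/3⌉. Conversely, the block of
-- columns {middle}, {top, bottom}, {middle} repeated, followed by {top, bottom} or {middle}, {top, bottom}
-- when 3 ∤ n, is 2-dominating with ⌈4n/3⌉ vertices.

open import Defs
open import Data.Bool using (Bool; true; false; _∧_; _∨_; not; if_then_else_; T)
open import Data.Bool.Properties using (T-∧)
open import Data.Empty using (⊥-elim)
open import Data.Fin using (Fin; toℕ; zero; suc)
open import Data.Fin.Properties using (_≟_)
open import Data.List using (List; []; _∷_; map; allFin; tabulate; concatMap; _++_; length; lookup)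
open import Data.List.Properties using (map-tabulate; map-++; map-∘)
open import Data.Nat using (ℕ; zero; suc; _+_; _*_; _/_; _≥_; _≤_; _≤ᵇ_; _≡ᵇ_)
open import Data.Nat.DivMod using (+-distrib-/-∣ʳ; m<n*o⇒m/o<n)
open import Data.Nat.Divisibility using (divides)
open import Data.Nat.ListAction using (sum)
open import Data.Nat.ListAction.Properties using (sum-++)
open import Data.Nat.Properties
  using (+-identityʳ; +-assoc; +-comm; *-zeroʳ; *-suc; *-distribˡ-+; +-cancelˡ-≤; +-monoˡ-≤; +-monoʳ-≤;
         +-monoʳ-<; ≤-reflexive; n<1+n; m<1+n⇒m≤n; ≤ᵇ⇒≤; ≤⇒≤ᵇ; +-0-commutativeMonoid; module ≤-Reasoning)
open import Data.Nat.Tactic.RingSolver using (solve-∀)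
open import Data.Product using (Σ; _×_; _,_; proj₁; proj₂)
open import Function using (_∘_; id)
open import Function.Bundles using (Equivalence; _⇔_; mk⇔)
open import Relation.Binary.PropositionalEquality
open import Relation.Nullary using (¬_)
open import Relation.Nullary.Decidable using (⌊_⌋; ⌊⌋-map′; toWitness)
open import Algebra.Properties.CommutativeMonoid.Sum +-0-commutativeMonoid
  using (sum-syntax; sum-cong-≗; sum-replicate-zero; ∑-distrib-+; ∑-comm)
  renaming (sum to ∑)

indicator : Bool → ℕ
indicator b = if b then 1 else 0

split-∧ : ∀ x {y} → T (x ∧ y) → T x × T y
split-∧ x = Equivalence.to (T-∧ {x})

sum-tabulate : ∀ {n} (f : Fin n → ℕ) → sum (tabulate f) ≡ ∑ f
sum-tabulate {zero}  f = refl
sum-tabulate {suc n} f = cong (f zero +_) (sum-tabulate (f ∘ suc))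

sum-map-allFin : ∀ {n} (f : Fin n → ℕ) → sum (map f (allFin n)) ≡ ∑ f
sum-map-allFin f = trans (cong sum (map-tabulate id f)) (sum-tabulate f)

sum-map-concatMap : ∀ {A B : Set} (f : B → ℕ) (g : A → List B) xs →
  sum (map f (concatMap g xs)) ≡ sum (map (λ x → sum (map f (g x))) xs)
sum-map-concatMap f g []       = refl
sum-map-concatMap f g (x ∷ xs) = begin
  sum (map f (g x ++ concatMap g xs))               ≡⟨ cong sum (map-++ f (g x) _) ⟩
  sum (map f (g x) ++ map f (concatMap g xs))       ≡⟨ sum-++ (map f (g x)) _ ⟩
  sum (map f (g x)) + sum (map f (concatMap g xs))  ≡⟨ cong (_ +_) (sum-map-concatMap f g xs) ⟩
  sum (map f (g x)) + sum (map (λ x → sum (map f (g x))) xs) ∎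
  where open ≡-Reasoning

count≡∑∑ : ∀ {m n} (P : Vertex m n → Bool) → count P ≡ ∑[ i < m ] ∑[ j < n ] indicator (P (i , j))
count≡∑∑ {m} {n} P = begin
  count P
    ≡⟨ sum-map-concatMap _ (λ i → map (i ,_) (allFin n)) (allFin m) ⟩
  sum (map (λ i → sum (map (indicator ∘ P) (map (i ,_) (allFin n)))) (allFin m))
    ≡⟨ sum-map-allFin {m} _ ⟩
  ∑[ i < m ] sum (map (indicator ∘ P) (map (i ,_) (allFin n)))
    ≡⟨ sum-cong-≗ {m} (λ i → cong sum (sym (map-∘ (allFin n)))) ⟩
  ∑[ i < m ] sum (map (λ j → indicator (P (i , j))) (allFin n))
    ≡⟨ sum-cong-≗ {m} (λ i → sum-map-allFin {n} _) ⟩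
  ∑[ i < m ] ∑[ j < n ] indicator (P (i , j)) ∎
  where open ≡-Reasoning

∑-if : ∀ {n} x (f : Fin n → ℕ) → ∑[ j < n ] (if x then f j else 0) ≡ (if x then ∑ f else 0)
∑-if     true  f = refl
∑-if {n} false f = sum-replicate-zero n

∑-point : ∀ {n} (i : Fin n) (f : Fin n → ℕ) → ∑[ j < n ] (if ⌊ i ≟ j ⌋ then f j else 0) ≡ f i
∑-point {suc n} zero    f = trans (cong (f zero +_) (sum-replicate-zero n)) (+-identityʳ _)
∑-point {suc n} (suc i) f = trans (sum-cong-≗ {n} peel) (∑-point i (f ∘ suc))
  where
  peel : ∀ j → (if ⌊ suc i ≟ suc j ⌋ then f (suc j) else 0) ≡ (if ⌊ i ≟ j ⌋ then f (suc j) else 0)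
  peel j = cong (if_then f (suc j) else 0) (⌊⌋-map′ _ _ (i ≟ j))

extend : ∀ {A : Set} {n} → A → (Fin n → A) → ℕ → A
extend {n = zero}  d F k       = d
extend {n = suc n} d F zero    = F zero
extend {n = suc n} d F (suc k) = extend d (F ∘ suc) k

extend-toℕ : ∀ {A : Set} {n} (d : A) (F : Fin n → A) (j : Fin n) → extend d F (toℕ j) ≡ F j
extend-toℕ d F zero    = refl
extend-toℕ d F (suc j) = extend-toℕ d (F ∘ suc) j

extend-end : ∀ {A : Set} n (d : A) (F : Fin n → A) → extend d F n ≡ d
extend-end zero    d F = refl
extend-end (suc n) d F = extend-end n d (F ∘ suc)

extend-map : ∀ {A B : Set} {n} (f : A → B) (d : A) (F : Fin n → A) k →
  f (extend d F k) ≡ extend (f d) (f ∘ F) k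
extend-map {n = zero}  f d F k       = refl
extend-map {n = suc n} f d F zero    = refl
extend-map {n = suc n} f d F (suc k) = extend-map f d (F ∘ suc) k

prepend : ∀ {A : Set} → A → (ℕ → A) → ℕ → A
prepend d f zero    = d
prepend d f (suc k) = f k

neighboursOnLine : ∀ {n} → (Fin n → Bool) → ℕ → ℕ
neighboursOnLine F a = indicator (prepend false (extend false F) a) + indicator (extend false F (suc a))

∑-line : ∀ {n} (F : Fin n → Bool) a →
  ∑[ j < n ] (if diff1 a (toℕ j) then indicator (F j) else 0) ≡ neighboursOnLine F a
∑-line {zero}  F zero          = refl
∑-line {zero}  F (suc a)       = refl
∑-line {suc n} F zero          = ∑-first (F ∘ suc)
  where
  ∑-first : ∀ {n} (G : Fin n → Bool) →
    ∑[ j < n ] (if (0 ≡ᵇ toℕ j) ∨ false then indicator (G j) else 0) ≡ indicator (extend false G 0)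
  ∑-first {zero}  G = refl
  ∑-first {suc n} G = trans (cong (indicator (G zero) +_) (sum-replicate-zero n)) (+-identityʳ _)
∑-line {suc n} F (suc zero)    = cong (indicator (F zero) +_) (∑-line (F ∘ suc) zero)
∑-line {suc n} F (suc (suc a)) = ∑-line (F ∘ suc) (suc a)

diff1-irrefl : ∀ a → ¬ T (diff1 a a)
diff1-irrefl zero    ()
diff1-irrefl (suc a) = diff1-irrefl a

indicator-∨-∧ : ∀ x y z w d → (T x → ¬ T w) →
  indicator (((x ∧ y) ∨ (z ∧ w)) ∧ d)
    ≡ (if x then (if y then indicator d else 0) else 0) + (if w then (if z then indicator d else 0) else 0)
indicator-∨-∧ true  y     z     true  d disjoint = ⊥-elim (disjoint _ _)
indicator-∨-∧ true  true  z     false d disjoint = sym (+-identityʳ _)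
indicator-∨-∧ true  false true  false d disjoint = refl
indicator-∨-∧ true  false false false d disjoint = refl
indicator-∨-∧ false y     true  true  d disjoint = refl
indicator-∨-∧ false y     false true  d disjoint = refl
indicator-∨-∧ false y     true  false d disjoint = refl
indicator-∨-∧ false y     false false d disjoint = refl

nbrsIn-grid : ∀ {m n} (D : VSet m n) (i : Fin m) (j : Fin n) →
  nbrsIn D (i , j) ≡ neighboursOnLine (λ j′ → D (i , j′)) (toℕ j) + neighboursOnLine (λ i′ → D (i′ , j)) (toℕ i)
nbrsIn-grid {m} {n} D i j = begin
  nbrsIn D (i , j)
    ≡⟨ count≡∑∑ (λ u → adj (i , j) u ∧ D u) ⟩
  ∑[ i′ < m ] ∑[ j′ < n ] indicator (adj (i , j) (i′ , j′) ∧ D (i′ , j′))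
    ≡⟨ sum-cong-≗ {m} (λ i′ → sum-cong-≗ {n} (split i′)) ⟩
  ∑[ i′ < m ] ∑[ j′ < n ] (horizontal i′ j′ + vertical i′ j′)
    ≡⟨ sum-cong-≗ {m} (λ i′ → ∑-distrib-+ (horizontal i′) (vertical i′)) ⟩
  ∑[ i′ < m ] (∑[ j′ < n ] horizontal i′ j′ + ∑[ j′ < n ] vertical i′ j′)
    ≡⟨ ∑-distrib-+ {m} (∑ ∘ horizontal) (∑ ∘ vertical) ⟩
  ∑[ i′ < m ] ∑[ j′ < n ] horizontal i′ j′ + ∑[ i′ < m ] ∑[ j′ < n ] vertical i′ j′
    ≡⟨ cong₂ _+_ ∑horizontal ∑vertical ⟩
  neighboursOnLine (λ j′ → D (i , j′)) (toℕ j) + neighboursOnLine (λ i′ → D (i′ , j)) (toℕ i) ∎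
  where
  open ≡-Reasoning
  horizontal vertical : Fin m → Fin n → ℕ
  horizontal i′ j′ =
    if ⌊ i ≟ i′ ⌋ then (if diff1 (toℕ j) (toℕ j′) then indicator (D (i′ , j′)) else 0) else 0
  vertical i′ j′ =
    if diff1 (toℕ i) (toℕ i′) then (if ⌊ j ≟ j′ ⌋ then indicator (D (i′ , j′)) else 0) else 0

  split : ∀ i′ j′ → indicator (adj (i , j) (i′ , j′) ∧ D (i′ , j′)) ≡ horizontal i′ j′ + vertical i′ j′
  split i′ j′ = indicator-∨-∧ ⌊ i ≟ i′ ⌋ _ ⌊ j ≟ j′ ⌋ _ _
    (λ i≡i′ → subst (λ k → ¬ T (diff1 (toℕ i) (toℕ k))) (toWitness i≡i′) (diff1-irrefl (toℕ i)))

  ∑horizontal : ∑[ i′ < m ] ∑[ j′ < n ] horizontal i′ j′ ≡ neighboursOnLine (λ j′ → D (i , j′)) (toℕ j)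
  ∑horizontal = begin
    ∑[ i′ < m ] ∑[ j′ < n ] horizontal i′ j′
      ≡⟨ sum-cong-≗ {m} (λ i′ → ∑-if {n} ⌊ i ≟ i′ ⌋ _) ⟩
    ∑[ i′ < m ] (if ⌊ i ≟ i′ ⌋
                   then ∑[ j′ < n ] (if diff1 (toℕ j) (toℕ j′) then indicator (D (i′ , j′)) else 0)
                   else 0)
      ≡⟨ ∑-point i _ ⟩
    ∑[ j′ < n ] (if diff1 (toℕ j) (toℕ j′) then indicator (D (i , j′)) else 0)
      ≡⟨ ∑-line (λ j′ → D (i , j′)) (toℕ j) ⟩
    neighboursOnLine (λ j′ → D (i , j′)) (toℕ j) ∎

  ∑vertical : ∑[ i′ < m ] ∑[ j′ < n ] vertical i′ j′ ≡ neighboursOnLine (λ i′ → D (i′ , j)) (toℕ i)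
  ∑vertical = begin
    ∑[ i′ < m ] ∑[ j′ < n ] vertical i′ j′
      ≡⟨ sum-cong-≗ {m} (λ i′ → ∑-if {n} (diff1 (toℕ i) (toℕ i′)) _) ⟩
    ∑[ i′ < m ] (if diff1 (toℕ i) (toℕ i′)
                   then ∑[ j′ < n ] (if ⌊ j ≟ j′ ⌋ then indicator (D (i′ , j′)) else 0)
                   else 0)
      ≡⟨ sum-cong-≗ {m} (λ i′ → cong (if diff1 (toℕ i) (toℕ i′) then_else 0) (∑-point j _)) ⟩
    ∑[ i′ < m ] (if diff1 (toℕ i) (toℕ i′) then indicator (D (i′ , j)) else 0)
      ≡⟨ ∑-line (λ i′ → D (i′ , j)) (toℕ i) ⟩
    neighboursOnLine (λ i′ → D (i′ , j)) (toℕ i) ∎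

-- Columns of a 3 × n grid

Column : Set
Column = Bool × Bool × Bool

empty : Column
empty = false , false , false

size : Column → ℕ
size (t , m , b) = indicator t + indicator m + indicator b

column : ∀ {n} → VSet 3 n → Fin n → Column
column D j = D (zero , j) , D (suc zero , j) , D (suc (suc zero) , j)

-- columns D (suc k) is column k of D; columns D 0 and columns D (suc k) for k ≥ n are empty.
columns : ∀ {n} → VSet 3 n → ℕ → Column
columns D k = paddedRow zero , paddedRow (suc zero) , paddedRow (suc (suc zero))
  where
  paddedRow : Fin 3 → Bool
  paddedRow i = prepend false (extend false (λ j → D (i , j))) k

columns-inside : ∀ {n} (D : VSet 3 n) (j : Fin n) → columns D (suc (toℕ j)) ≡ column D j
columns-inside D j =
  cong₂ _,_ (extend-toℕ false _ j) (cong₂ _,_ (extend-toℕ false _ j) (extend-toℕ false _ j))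

columns-beyond : ∀ {n} (D : VSet 3 n) → columns D (suc n) ≡ empty
columns-beyond {n} D =
  cong₂ _,_ (extend-end n false _) (cong₂ _,_ (extend-end n false _) (extend-end n false _))

card≡∑size : ∀ {n} (D : VSet 3 n) → card D ≡ ∑[ j < n ] size (column D j)
card≡∑size {n} D = begin
  card D                                       ≡⟨ count≡∑∑ D ⟩
  ∑[ i < 3 ] ∑[ j < n ] indicator (D (i , j))  ≡⟨ ∑-comm (λ i j → indicator (D (i , j))) ⟩
  ∑[ j < n ] ∑[ i < 3 ] indicator (D (i , j))  ≡⟨ sum-cong-≗ {n} (λ j → regroup (column D j)) ⟩
  ∑[ j < n ] size (column D j)                 ∎
  where
  open ≡-Reasoning
  regroup : ∀ ((t , m , b) : Column) → indicator t + (indicator m + (indicator b + 0)) ≡ size (t , m , b)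
  regroup (t , m , b) =
    trans (cong (λ k → indicator t + (indicator m + k)) (+-identityʳ _)) (sym (+-assoc (indicator t) _ _))

twoDominated : Bool → ℕ → Bool
twoDominated x k = x ∨ (2 ≤ᵇ k)

twoDominated-sound : ∀ x k → T (twoDominated x k) → x ≡ false → 2 ≤ k
twoDominated-sound false k h refl = ≤ᵇ⇒≤ 2 k h

twoDominated-complete : ∀ x k → (x ≡ false → 2 ≤ k) → T (twoDominated x k)
twoDominated-complete true  k _ = _
twoDominated-complete false k h = ≤⇒≤ᵇ (h refl)

twoDominatedAt : ∀ {m n} → VSet m n → Vertex m n → Bool
twoDominatedAt D v = twoDominated (D v) (nbrsIn D v)

-- Each count is written as nbrsIn-grid produces it: horizontal neighbours, then vertical ones (0 off the grid).
dominated : Column → Column → Column → Bool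
dominated (t₀ , m₀ , b₀) (t , m , b) (t₂ , m₂ , b₂) =
  twoDominated t ((indicator t₀ + indicator t₂) + (0 + indicator m)) ∧
  (twoDominated m ((indicator m₀ + indicator m₂) + (indicator t + indicator b)) ∧
   twoDominated b ((indicator b₀ + indicator b₂) + (indicator m + 0)))

Dominated : Column → Column → Column → Set
Dominated p q r = T (dominated p q r)

dominated-columns : ∀ {n} (D : VSet 3 n) (j : Fin n) →
  dominated (columns D (toℕ j)) (columns D (suc (toℕ j))) (columns D (suc (suc (toℕ j))))
    ≡ twoDominatedAt D (zero , j) ∧ (twoDominatedAt D (suc zero , j) ∧ twoDominatedAt D (suc (suc zero) , j))
dominated-columns D j
  rewrite nbrsIn-grid D zero j | nbrsIn-grid D (suc zero) j | nbrsIn-grid D (suc (suc zero)) j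
        | extend-toℕ false (λ j′ → D (zero , j′)) j
        | extend-toℕ false (λ j′ → D (suc zero , j′)) j
        | extend-toℕ false (λ j′ → D (suc (suc zero) , j′)) j
        = refl

T-∧-Fin3 : (f : Fin 3 → Bool) → T (f zero ∧ (f (suc zero) ∧ f (suc (suc zero)))) ⇔ (∀ i → T (f i))
T-∧-Fin3 f = mk⇔ project combine
  where
  project : T (f zero ∧ (f (suc zero) ∧ f (suc (suc zero)))) → ∀ i → T (f i)
  project h zero             = proj₁ (split-∧ (f zero) h)
  project h (suc zero)       = proj₁ (split-∧ (f (suc zero)) (proj₂ (split-∧ (f zero) h)))
  project h (suc (suc zero)) = proj₂ (split-∧ (f (suc zero)) (proj₂ (split-∧ (f zero) h)))
  combine : (∀ i → T (f i)) → T (f zero ∧ (f (suc zero) ∧ f (suc (suc zero))))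
  combine h = Equivalence.from T-∧ (h zero , Equivalence.from T-∧ (h (suc zero) , h (suc (suc zero))))

AllWindows : ∀ {C : Set} → (C → C → C → Set) → ℕ → (ℕ → C) → Set
AllWindows ok n s = (j : Fin n) → ok (s (toℕ j)) (s (suc (toℕ j))) (s (suc (suc (toℕ j))))

AllWindows-cong : ∀ {C : Set} {ok : C → C → C → Set} {n} {s s′ : ℕ → C} →
  s ≗ s′ → AllWindows ok n s → AllWindows ok n s′
AllWindows-cong {ok = ok} s≗s′ windows j =
  subst₂ (λ x yz → ok x (proj₁ yz) (proj₂ yz)) (s≗s′ _) (cong₂ _,_ (s≗s′ _) (s≗s′ _)) (windows j)

Is2Dominating⇒AllWindows : ∀ {n} (D : VSet 3 n) → Is2Dominating D → AllWindows Dominated n (columns D)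
Is2Dominating⇒AllWindows D dominating j rewrite dominated-columns D j =
  Equivalence.from (T-∧-Fin3 (λ i → twoDominatedAt D (i , j)))
    (λ i → twoDominated-complete _ _ (dominating (i , j)))

AllWindows⇒Is2Dominating : ∀ {n} (D : VSet 3 n) → AllWindows Dominated n (columns D) → Is2Dominating D
AllWindows⇒Is2Dominating D windows (i , j) =
  twoDominated-sound _ _
    (Equivalence.to (T-∧-Fin3 (λ i → twoDominatedAt D (i , j))) (subst T (dominated-columns D j) (windows j)) i)

-- The potential argument

module _ {C : Set} (ok : C → C → C → Set) (weight : C → ℕ) (Φ : C → C → ℕ) {a b : ℕ}
         (step : ∀ {p q r} → ok p q r → Φ p q + a ≤ b * weight q + Φ q r) where

  telescope : ∀ n (s : ℕ → C) → AllWindows ok n s →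
    Φ (s 0) (s 1) + a * n ≤ b * ∑[ j < n ] weight (s (suc (toℕ j))) + Φ (s n) (s (suc n))
  telescope zero    s _       = ≤-reflexive (begin
    Φ (s 0) (s 1) + a * 0  ≡⟨ cong (Φ (s 0) (s 1) +_) (*-zeroʳ a) ⟩
    Φ (s 0) (s 1) + 0      ≡⟨ +-identityʳ _ ⟩
    Φ (s 0) (s 1)          ≡⟨ cong (_+ Φ (s 0) (s 1)) (*-zeroʳ b) ⟨
    b * 0 + Φ (s 0) (s 1)  ∎)
    where open ≡-Reasoning
  telescope (suc n) s windows = chain (step (windows zero)) (telescope n (s ∘ suc) (windows ∘ suc))
    where
    chain : ∀ {x y z u v} → x + a ≤ b * u + y → y + a * n ≤ b * v + z → x + a * suc n ≤ b * (u + v) + z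
    chain {x} {y} {z} {u} {v} first rest = begin
      x + a * suc n        ≡⟨ cong (x +_) (*-suc a n) ⟩
      x + (a + a * n)      ≡⟨ +-assoc x a (a * n) ⟨
      x + a + a * n        ≤⟨ +-monoˡ-≤ (a * n) first ⟩
      b * u + y + a * n    ≡⟨ +-assoc (b * u) y (a * n) ⟩
      b * u + (y + a * n)  ≤⟨ +-monoʳ-≤ (b * u) rest ⟩
      b * u + (b * v + z)  ≡⟨ +-assoc (b * u) (b * v) z ⟨
      b * u + b * v + z    ≡⟨ cong (_+ z) (*-distribˡ-+ b u v) ⟨
      b * (u + v) + z      ∎
      where open ≤-Reasoning

-- The value 20 stands for +∞: in such a pair (p , q) the top (resp. bottom) vertex of q is outside D with at
-- most one neighbour in D, so the pair occurs in no dominated window.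
potential : Column → Column → ℕ
potential _                  (false , false , false) = 1
potential (false , _ , _)    (false , false , true)  = 20
potential (true , true , _)  (false , false , true)  = 1
potential (true , false , _) (false , false , true)  = 2
potential (true , _ , true)  (false , true , false)  = 0
potential _                  (false , true , false)  = 1
potential _                  (false , true , true)   = 3
potential (_ , _ , false)    (true , false , false)  = 20
potential (_ , true , true)  (true , false , false)  = 1
potential (_ , false , true) (true , false , false)  = 2
potential _                  (true , false , true)   = 2
potential _                  (true , true , false)   = 3
potential _                  (true , true , true)    = 5

allBool : (Bool → Bool) → Bool
allBool f = f false ∧ f true

allBool-sound : ∀ (f : Bool → Bool) → T (allBool f) → ∀ x → T (f x)
allBool-sound f h false = proj₁ (split-∧ (f false) h)
allBool-sound f h true  = proj₂ (split-∧ (f false) h)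

allColumns : (Column → Bool) → Bool
allColumns f = allBool λ t → allBool λ m → allBool λ b → f (t , m , b)

allColumns-sound : ∀ (f : Column → Bool) → T (allColumns f) → ∀ c → T (f c)
allColumns-sound f h (t , m , b) =
  allBool-sound (λ b → f (t , m , b))
    (allBool-sound (λ m → allBool λ b → f (t , m , b))
      (allBool-sound (λ t → allBool λ m → allBool λ b → f (t , m , b)) h t) m) b

allColumns³-sound : ∀ (f : Column → Column → Column → Bool) →
  T (allColumns λ p → allColumns λ q → allColumns λ r → f p q r) → ∀ p q r → T (f p q r)
allColumns³-sound f h p q r =
  allColumns-sound (f p q)
    (allColumns-sound (λ q → allColumns (f p q))
      (allColumns-sound (λ p → allColumns λ q → allColumns (f p q)) h p) q) r

potential-step : ∀ {p q r} → Dominated p q r → potential p q + 4 ≤ 3 * size q + potential q r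
potential-step {p} {q} {r} = ≤ᵇ⇒≤ _ _ ∘ modus-ponens (allColumns³-sound step? _ p q r)
  where
  step? : Column → Column → Column → Bool
  step? p q r = not (dominated p q r) ∨ (potential p q + 4 ≤ᵇ 3 * size q + potential q r)
  modus-ponens : ∀ {x y} → T (not x ∨ y) → T x → T y
  modus-ponens {true} h _ = h

1≤potential-empty : ∀ q → 1 ≤ potential empty q
1≤potential-empty q = ≤ᵇ⇒≤ 1 _ (allColumns-sound (λ q → 1 ≤ᵇ potential empty q) _ q)

potential-empty≤1 : ∀ p → potential p empty ≤ 1
potential-empty≤1 p = ≤ᵇ⇒≤ _ 1 (allColumns-sound (λ p → potential p empty ≤ᵇ 1) _ p)

4n≤3*card : ∀ {n} (D : VSet 3 n) → Is2Dominating D → 4 * n ≤ 3 * card D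
4n≤3*card {n} D dominating = +-cancelˡ-≤ 1 _ _ (begin
  1 + 4 * n
    ≤⟨ +-monoˡ-≤ (4 * n) (1≤potential-empty (columns D 1)) ⟩
  potential (columns D 0) (columns D 1) + 4 * n
    ≤⟨ telescope Dominated size potential {4} {3} potential-step n (columns D)
         (Is2Dominating⇒AllWindows D dominating) ⟩
  3 * ∑[ j < n ] size (columns D (suc (toℕ j))) + potential (columns D n) (columns D (suc n))
    ≡⟨ cong₂ (λ S c → 3 * S + potential (columns D n) c) sizes (columns-beyond D) ⟩
  3 * card D + potential (columns D n) empty
    ≤⟨ +-monoʳ-≤ (3 * card D) (potential-empty≤1 (columns D n)) ⟩
  3 * card D + 1
    ≡⟨ +-comm _ 1 ⟩
  1 + 3 * card D ∎)
  where
  open ≤-Reasoning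
  sizes : ∑[ j < n ] size (columns D (suc (toℕ j))) ≡ card D
  sizes = trans (sum-cong-≗ {n} (cong size ∘ columns-inside D)) (sym (card≡∑size D))

4n≤3c⇒[4n+2]/3≤c : ∀ n c → 4 * n ≤ 3 * c → (4 * n + 2) / 3 ≤ c
4n≤3c⇒[4n+2]/3≤c n c 4n≤3c = m<1+n⇒m≤n (m<n*o⇒m/o<n (begin-strict
  4 * n + 2  <⟨ +-monoʳ-< (4 * n) (n<1+n 2) ⟩
  4 * n + 3  ≤⟨ +-monoˡ-≤ 3 4n≤3c ⟩
  3 * c + 3  ≡⟨ regroup c ⟩
  suc c * 3  ∎))
  where
  open ≤-Reasoning
  regroup : ∀ c → 3 * c + 3 ≡ suc c * 3
  regroup = solve-∀

-- The construction

padded : List Column → ℕ → Column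
padded L = extend empty (lookup L)

padded-∷ : ∀ q L → padded (q ∷ L) ≗ prepend q (padded L)
padded-∷ q L zero    = refl
padded-∷ q L (suc k) = refl

dominatedList : Column → List Column → Bool
dominatedList p []      = true
dominatedList p (q ∷ L) = dominated p q (padded L 0) ∧ dominatedList q L

dominatedList⇒AllWindows : ∀ p L → T (dominatedList p L) →
  AllWindows Dominated (length L) (prepend p (padded L))
dominatedList⇒AllWindows p (q ∷ L) h zero    = proj₁ (split-∧ (dominated p q (padded L 0)) h)
dominatedList⇒AllWindows p (q ∷ L) h (suc j) =
  subst (λ c → Dominated c (padded L (toℕ j)) (padded L (suc (toℕ j)))) (sym (padded-∷ q L (toℕ j)))
    (dominatedList⇒AllWindows q L (proj₂ (split-∧ (dominated p q (padded L 0)) h)) j)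

fromColumns : (L : List Column) → VSet 3 (length L)
fromColumns L (zero , j)           = proj₁ (lookup L j)
fromColumns L (suc zero , j)       = proj₁ (proj₂ (lookup L j))
fromColumns L (suc (suc zero) , j) = proj₂ (proj₂ (lookup L j))

columns-fromColumns : ∀ L → columns (fromColumns L) ≗ prepend empty (padded L)
columns-fromColumns L zero    = refl
columns-fromColumns L (suc k) =
  cong₂ _,_ (sym (extend-map proj₁ empty (lookup L) k))
    (cong₂ _,_ (sym (extend-map (proj₁ ∘ proj₂) empty (lookup L) k))
               (sym (extend-map (proj₂ ∘ proj₂) empty (lookup L) k)))

fromColumns-2dominating : ∀ L → T (dominatedList empty L) → Is2Dominating (fromColumns L)
fromColumns-2dominating L h =
  AllWindows⇒Is2Dominating (fromColumns L)
    (AllWindows-cong {ok = Dominated} (sym ∘ columns-fromColumns L) (dominatedList⇒AllWindows empty L h))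

∑-lookup : ∀ (f : Column → ℕ) L → ∑[ j < length L ] f (lookup L j) ≡ sum (map f L)
∑-lookup f []      = refl
∑-lookup f (q ∷ L) = cong (f q +_) (∑-lookup f L)

card-fromColumns : ∀ L → card (fromColumns L) ≡ sum (map size L)
card-fromColumns L = trans (card≡∑size (fromColumns L)) (∑-lookup size L)

mid ends : Column
mid  = false , true , false
ends = true , false , true

tiling : ℕ → List Column
tiling 0                          = []
tiling 1                          = ends ∷ []
tiling 2                          = mid ∷ ends ∷ []
tiling 3                          = mid ∷ ends ∷ mid ∷ []
tiling (suc (suc (suc (suc n)))) = mid ∷ ends ∷ mid ∷ tiling (suc n)

length-tiling : ∀ n → length (tiling n) ≡ n
length-tiling 0                          = refl
length-tiling 1                          = refl
length-tiling 2                          = refl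
length-tiling 3                          = refl
length-tiling (suc (suc (suc (suc n)))) = cong (3 +_) (length-tiling (suc n))

tiling-dominated : ∀ n p → T (dominatedList p (tiling n))
tiling-dominated 0                          p = _
tiling-dominated 1                          p = allColumns-sound (λ p → dominatedList p (tiling 1)) _ p
tiling-dominated 2                          p = allColumns-sound (λ p → dominatedList p (tiling 2)) _ p
tiling-dominated 3                          p = allColumns-sound (λ p → dominatedList p (tiling 3)) _ p
tiling-dominated (suc (suc (suc (suc n)))) p =
  block p (padded (tiling (suc n)) 0) (dominatedList mid (tiling (suc n))) (tiling-dominated (suc n) mid)
  where
  block? : Column → Column → Bool
  block? p r = dominated p mid ends ∧ (dominated mid ends mid ∧ (dominated ends mid r ∧ true))
  block : ∀ p r x → T x → T (dominated p mid ends ∧ (dominated mid ends mid ∧ (dominated ends mid r ∧ x)))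
  block p r true _ = allColumns-sound (block? p) (allColumns-sound (allColumns ∘ block?) _ p) r

[4[3+n]+2]/3≡4+[4n+2]/3 : ∀ n → (4 * (3 + n) + 2) / 3 ≡ 4 + (4 * n + 2) / 3
[4[3+n]+2]/3≡4+[4n+2]/3 n = begin
  (4 * (3 + n) + 2) / 3    ≡⟨ cong (_/ 3) (regroup n) ⟩
  (4 * n + 2 + 4 * 3) / 3  ≡⟨ +-distrib-/-∣ʳ (4 * n + 2) (divides 4 refl) ⟩
  (4 * n + 2) / 3 + 4      ≡⟨ +-comm _ 4 ⟩
  4 + (4 * n + 2) / 3      ∎
  where
  open ≡-Reasoning
  regroup : ∀ n → 4 * (3 + n) + 2 ≡ 4 * n + 2 + 4 * 3
  regroup = solve-∀

size-tiling : ∀ n → sum (map size (tiling n)) ≡ (4 * n + 2) / 3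
size-tiling 0                          = refl
size-tiling 1                          = refl
size-tiling 2                          = refl
size-tiling 3                          = refl
size-tiling (suc (suc (suc (suc n)))) =
  trans (cong (4 +_) (size-tiling (suc n))) (sym ([4[3+n]+2]/3≡4+[4n+2]/3 (suc n)))

theorem2 : (n : ℕ) → n ≥ 1 → Gamma2Is 3 n ((4 * n + 2) / 3)
theorem2 n _ = optimal , λ D dominating → 4n≤3c⇒[4n+2]/3≤c n (card D) (4n≤3*card D dominating)
  where
  optimal : Σ (VSet 3 n) λ D → Is2Dominating D × card D ≡ (4 * n + 2) / 3
  optimal = subst (λ k → Σ (VSet 3 k) λ D → Is2Dominating D × card D ≡ (4 * n + 2) / 3) (length-tiling n)
    ( fromColumns (tiling n)
    , fromColumns-2dominating (tiling n) (tiling-dominated n empty)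
    , trans (card-fromColumns (tiling n)) (size-tiling n))
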